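{- Let $\mathbf{R}\in\mathbb{F}^{N\times N}$ with characteristic polynomial $c_{\mathbf{R}}(X)=\det(X\mathbf{I}-\mathbf{R})$, let $t\ge1$, and let $g_{i,j}\in\mathbb{F}[X]$ for $0\le i<M$, $1\le j\le t$ (with $g_{i,j}=0$ for $j>i$), and $g_{i,0}=1$ for all $i$. Let $\mathbf{G}\in\mathbb{F}[X]^{M\times M}$ be given by $\mathbf{G}[i,i]=1$, $\mathbf{G}[i,j]=-g_{i,i-j}(X)$ for $1\le i-j\le t$, and $\mathbf{G}[i,j]=0$ otherwise, and let $\mathbf{H}=(h_{i,j}(X))\in\mathbb{F}[X]^{M\times M}$ satisfy $\mathbf{H}\equiv\mathbf{G}^{ -1}\pmod{c_{\mathbf{R}}(X)}$. For $0\le i<M-1$ let $\mathbf{T}_i\in\mathbb{F}[X]^{t\times t}$ be the matrix with $\mathbf{T}_i[k,k+1]=1$ for $0\le k<t-1$, last row $\big(g_{i+1,t}(X),g_{i+1,t-1}(X),\dots,g_{i+1,1}(X)\big)$, and all other entries $0$; for $\ell\le r$ let $\mathbf{T}_{[\ell:r]}=\mathbf{T}_{r-1}\mathbf{T}_{r-2}\cdots\mathbf{T}_{\ell}$ (with $\mathbf{T}_{[\ell:\ell]}=\mathbf{I}_t$). Then for all $0\le j\le i<M$, $$h_{i,j}(X)\equiv \mathbf{T}_{[j:i]}[t-1,t-1]\pmod{c_{\mathbf{R}}(X)},$$ i.e. $h_{i,j}$ is, modulo $c_{\mathbf{R}}$, the bottom-right entry of $\mathbf{T}_{[j:i]}$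.
   Context: $\mathbb{F}$ is a field; matrix indices start at $0$. Here $\mathbf{G}$ is the coefficient matrix of a recurrence $\mathbf{a}_i=\sum_{j=1}^{\min(t,i)}g_{i,j}(\mathbf{R})\mathbf{a}_{i-j}+\mathbf{f}_i$. -}

module Defs where

open import Level using (Level; _⊔_; suc; Lift)
open import Algebra.Bundles using (CommutativeRing)
open import Data.Nat as ℕ using (ℕ; zero; _∸_)
open import Data.Fin as Fin using (Fin; toℕ; punchIn)
open import Data.List using (List; []; _∷_; map)
open import Data.Product using (Σ; ∃; _×_; _,_)
open import Data.Unit.Polymorphic using (⊤)
open import Relation.Nullary using (¬_)
open import Relation.Nullary.Decidable using (does)
open import Data.Bool using (if_then_else_; _∧_)

record Field (c ℓ : Level) : Set (Level.suc (c ⊔ ℓ)) where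
  field
    commutativeRing : CommutativeRing c ℓ
  open CommutativeRing commutativeRing public
  field
    1≉0   : ¬ (1# ≈ 0#)
    inverse : ∀ x → ¬ (x ≈ 0#) → Σ Carrier (λ y → x * y ≈ 1#)

-- Univariate polynomials F[X] over a field, as coefficient lists
-- (constant coefficient first), with the evident operations and the
-- equality "same coefficients up to trailing zeros".

module Poly {c ℓ} (F : Field c ℓ) where
  open Field F

  P : Set c
  P = List Carrier

  infix 4 _≈P_
  infix 4 _≡_mod_
  _≈P_ : P → P → Set ℓ
  []      ≈P []      = ⊤
  []      ≈P (b ∷ q) = (b ≈ 0#) × ([] ≈P q)
  (a ∷ p) ≈P []      = (a ≈ 0#) × (p ≈P [])
  (a ∷ p) ≈P (b ∷ q) = (a ≈ b) × (p ≈P q)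

  0P : P
  0P = []

  const : Carrier → P
  const a = a ∷ []

  1P : P
  1P = const 1#

  XP : P
  XP = 0# ∷ 1# ∷ []

  infixl 6 _+P_ _-P_
  infixl 7 _*P_
  _+P_ : P → P → P
  []      +P q       = q
  (a ∷ p) +P []      = a ∷ p
  (a ∷ p) +P (b ∷ q) = (a + b) ∷ (p +P q)

  -P_ : P → P
  -P p = map -_ p

  _-P_ : P → P → P
  p -P q = p +P (-P q)

  _*P_ : P → P → P
  []      *P q = []
  (a ∷ p) *P q = map (a *_) q +P (0# ∷ (p *P q))

  _≡_mod_ : P → P → P → Set (c ⊔ ℓ)
  p ≡ q mod m = ∃ λ k → p -P q ≈P k *P m

  Mat : ℕ → Set c
  Mat n = Fin n → Fin n → P

  ΣP : ∀ {n} → (Fin n → P) → P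
  ΣP {zero}    f = 0P
  ΣP {ℕ.suc n} f = f Fin.zero +P ΣP (λ k → f (Fin.suc k))

  infixl 7 _⊗_
  _⊗_ : ∀ {n} → Mat n → Mat n → Mat n
  (A ⊗ B) i j = ΣP (λ k → A i k *P B k j)

  I : ∀ {n} → Mat n
  I i j = if does (i Fin.≟ j) then 1P else 0P

  infix 4 _≈M_
  _≈M_ : ∀ {n} → Mat n → Mat n → Set ℓ
  A ≈M B = ∀ i j → A i j ≈P B i j

  sign : ℕ → P
  sign zero          = 1P
  sign (ℕ.suc zero)  = -P 1P
  sign (ℕ.suc (ℕ.suc k)) = sign k

  det : ∀ {n} → Mat n → P
  det {zero}    A = 1P
  det {ℕ.suc n} A =
    ΣP (λ k → sign (toℕ k) *P A Fin.zero k
                *P det (λ i j → A (Fin.suc i) (punchIn k j)))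

  charPoly : ∀ {N} → (Fin N → Fin N → Carrier) → P
  charPoly R = det (λ i j → (XP *P I i j) -P const (R i j))

  Gmat : (M t : ℕ) → (ℕ → ℕ → P) → Mat M
  Gmat M t g i j =
    if does (toℕ i ℕ.≟ toℕ j) then 1P
    else if does (toℕ j ℕ.<? toℕ i) ∧ does (toℕ i ∸ toℕ j ℕ.≤? t)
         then -P g (toℕ i) (toℕ i ∸ toℕ j)
         else 0P

  Tmat : (t : ℕ) → (ℕ → ℕ → P) → ℕ → Mat t
  Tmat t g i k l =
    if does (ℕ.suc (toℕ k) ℕ.≟ t) then g (ℕ.suc i) (t ∸ toℕ l)
    else if does (ℕ.suc (toℕ k) ℕ.≟ toℕ l) then 1P
    else 0P

  -- Tprod t g ℓ d = T_{[ℓ:ℓ+d]} = T_{ℓ+d-1} ⋯ T_{ℓ}   (T_{[ℓ:ℓ]} = I_t)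
  Tprod : (t : ℕ) → (ℕ → ℕ → P) → ℕ → ℕ → Mat t
  Tprod t g ℓ zero      = I
  Tprod t g ℓ (ℕ.suc d) = Tmat t g (ℓ ℕ.+ d) ⊗ Tprod t g ℓ d

  Tseg : (t : ℕ) → (ℕ → ℕ → P) → ℕ → ℕ → Mat t
  Tseg t g ℓ r = Tprod t g ℓ (r ∸ ℓ)

-- Fix a column j of G⁻¹ and let u k be its entry in row j + k.  Read by
-- forward substitution, row j + k of G·G⁻¹ = I gives zeros above row j,
-- u 0 = 1 and the recurrence u k = Σ_{1 ≤ m ≤ t} g_{j+k,m} u (k - m).  Hence
-- T_{j+d} maps the window (u (d - t + 1), …, u d), zero at negative indices,
-- to the next window, so the last column of T_{[j:j+d]} is the window at d,
-- whose last entry is u d = h_{j+d,j}.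
module Submission where

open import Defs
open import Data.Nat using (ℕ; zero; suc; _<_; _≤_; z<s; s<s)
open import Data.Fin using (Fin; toℕ; fromℕ)
import Data.Nat.Properties as ℕₚ
open import Data.Nat.Induction using (<-rec)
import Data.Fin as Fin
import Data.Fin.Properties as Finₚ
open import Data.List using ([]; _∷_; map)
open import Data.Product using (_,_)
open import Data.Bool using (true; false; if_then_else_; _∧_)
open import Relation.Nullary using (Dec; does; yes; no; contradiction)
open import Function using (_∘_)
open import Relation.Nullary.Decidable using (dec-true; dec-false)
open import Relation.Binary using (Setoid)
open import Relation.Binary.PropositionalEquality as ≡ using (_≡_; _≢_; cong)

-- _≈P_ is awkward to reason with directly; comparing coefficients gives an
-- equivalent setoid in which the ring laws are proved pointwise.
module Coefficientwise {c ℓ} (F : Field c ℓ) where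
  open Field F hiding (zero)
  open Poly F
  open import Algebra.Properties.Ring ring
    using (-0#≈0#; -‿involutive; -‿+-comm; -‿distribˡ-*; +-inverseʳ-unique)

  coeff : P → ℕ → Carrier
  coeff []      _       = 0#
  coeff (a ∷ p) zero    = a
  coeff (a ∷ p) (suc n) = coeff p n

  infix 4 _≃_
  record _≃_ (p q : P) : Set ℓ where
    constructor coeffwise
    field coeff-≈ : ∀ n → coeff p n ≈ coeff q n
  open _≃_ public

  ≃-setoid : Setoid c ℓ
  ≃-setoid = record
    { _≈_           = _≃_
    ; isEquivalence = record
      { refl  = coeffwise λ _ → refl
      ; sym   = λ p≃q → coeffwise λ n → sym (coeff-≈ p≃q n)
      ; trans = λ p≃q q≃r → coeffwise λ n → trans (coeff-≈ p≃q n) (coeff-≈ q≃r n)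
      }
    }

  open Setoid ≃-setoid public
    using () renaming (refl to ≃-refl; sym to ≃-sym; trans to ≃-trans; reflexive to ≡⇒≃)

  ≈P⇒≃ : ∀ p q → p ≈P q → p ≃ q
  ≈P⇒≃ p q p≈q = coeffwise (go p q p≈q)
    where
    go : ∀ p q → p ≈P q → ∀ n → coeff p n ≈ coeff q n
    go []      []      _          _       = refl
    go []      (b ∷ q) (b≈0 , _)  zero    = sym b≈0
    go []      (b ∷ q) (_ , []≈q) (suc n) = go [] q []≈q n
    go (a ∷ p) []      (a≈0 , _)  zero    = a≈0
    go (a ∷ p) []      (_ , p≈[]) (suc n) = go p [] p≈[] n
    go (a ∷ p) (b ∷ q) (a≈b , _)  zero    = a≈b
    go (a ∷ p) (b ∷ q) (_ , p≈q)  (suc n) = go p q p≈q n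

  ≃⇒≈P : ∀ p q → p ≃ q → p ≈P q
  ≃⇒≈P p q p≃q = go p q (coeff-≈ p≃q)
    where
    go : ∀ p q → (∀ n → coeff p n ≈ coeff q n) → p ≈P q
    go []      []      _ = _
    go []      (b ∷ q) e = sym (e zero) , go [] q (λ n → e (suc n))
    go (a ∷ p) []      e = e zero , go p [] (λ n → e (suc n))
    go (a ∷ p) (b ∷ q) e = e zero , go p q (λ n → e (suc n))

  ∷-cong : ∀ {a b p q} → a ≈ b → p ≃ q → a ∷ p ≃ b ∷ q
  ∷-cong a≈b p≃q = coeffwise λ { zero → a≈b ; (suc n) → coeff-≈ p≃q n }

  0∷-≃0P : ∀ {p} → p ≃ 0P → 0# ∷ p ≃ 0P
  0∷-≃0P p≃0 = coeffwise λ { zero → refl ; (suc n) → coeff-≈ p≃0 n }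

  coeff-+P : ∀ p q n → coeff (p +P q) n ≈ coeff p n + coeff q n
  coeff-+P []      q       n       = sym (+-identityˡ _)
  coeff-+P (a ∷ p) []      n       = sym (+-identityʳ _)
  coeff-+P (a ∷ p) (b ∷ q) zero    = refl
  coeff-+P (a ∷ p) (b ∷ q) (suc n) = coeff-+P p q n

  coeff-neg : ∀ p n → coeff (-P p) n ≈ - coeff p n
  coeff-neg []      n       = sym -0#≈0#
  coeff-neg (a ∷ p) zero    = refl
  coeff-neg (a ∷ p) (suc n) = coeff-neg p n

  coeff-map-* : ∀ a q n → coeff (map (a *_) q) n ≈ a * coeff q n
  coeff-map-* a []      n       = sym (zeroʳ a)
  coeff-map-* a (b ∷ q) zero    = refl
  coeff-map-* a (b ∷ q) (suc n) = coeff-map-* a q n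

  +P-cong : ∀ {p p′ q q′} → p ≃ p′ → q ≃ q′ → p +P q ≃ p′ +P q′
  +P-cong {p} {p′} {q} {q′} p≃p′ q≃q′ = coeffwise λ n →
    trans (coeff-+P p q n)
      (trans (+-cong (coeff-≈ p≃p′ n) (coeff-≈ q≃q′ n)) (sym (coeff-+P p′ q′ n)))

  +P-identityʳ : ∀ p → p +P 0P ≡ p
  +P-identityʳ []      = ≡.refl
  +P-identityʳ (a ∷ p) = ≡.refl

  +P-assoc : ∀ p q r → (p +P q) +P r ≃ p +P (q +P r)
  +P-assoc []      q       r       = ≃-refl
  +P-assoc (a ∷ p) []      r       = ≃-refl
  +P-assoc (a ∷ p) (b ∷ q) []      = ≃-refl
  +P-assoc (a ∷ p) (b ∷ q) (d ∷ r) = ∷-cong (+-assoc a b d) (+P-assoc p q r)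

  -P-cong : ∀ {p q} → p ≃ q → -P p ≃ -P q
  -P-cong {p} {q} p≃q = coeffwise λ n →
    trans (coeff-neg p n) (trans (-‿cong (coeff-≈ p≃q n)) (sym (coeff-neg q n)))

  -P-involutive : ∀ p → -P (-P p) ≃ p
  -P-involutive []      = ≃-refl
  -P-involutive (a ∷ p) = ∷-cong (-‿involutive a) (-P-involutive p)

  -P-+P : ∀ p q → -P (p +P q) ≃ -P p +P -P q
  -P-+P []      q       = ≃-refl
  -P-+P (a ∷ p) []      = ≃-refl
  -P-+P (a ∷ p) (b ∷ q) = ∷-cong (sym (-‿+-comm a b)) (-P-+P p q)

  +P-inverseʳ-unique : ∀ p q → p +P q ≃ 0P → q ≃ -P p
  +P-inverseʳ-unique p q p+q≃0 = coeffwise λ n →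
    trans (+-inverseʳ-unique (coeff p n) (coeff q n)
            (trans (sym (coeff-+P p q n)) (coeff-≈ p+q≃0 n)))
          (sym (coeff-neg p n))

  map-*-cong : ∀ a {q r} → q ≃ r → map (a *_) q ≃ map (a *_) r
  map-*-cong a {q} {r} q≃r = coeffwise λ n →
    trans (coeff-map-* a q n) (trans (*-cong refl (coeff-≈ q≃r n)) (sym (coeff-map-* a r n)))

  *P-congˡ : ∀ p {q r} → q ≃ r → p *P q ≃ p *P r
  *P-congˡ []      _   = ≃-refl
  *P-congˡ (a ∷ p) q≃r = +P-cong (map-*-cong a q≃r) (∷-cong refl (*P-congˡ p q≃r))

  *P-zeroʳ : ∀ p → p *P 0P ≃ 0P
  *P-zeroʳ []      = ≃-refl
  *P-zeroʳ (a ∷ p) = 0∷-≃0P (*P-zeroʳ p)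

  *P-identityˡ : ∀ q → 1P *P q ≃ q
  *P-identityˡ q = ≃-trans (+P-cong map-1* (0∷-≃0P ≃-refl)) (≡⇒≃ (+P-identityʳ q))
    where
    map-1* : map (1# *_) q ≃ q
    map-1* = coeffwise λ n → trans (coeff-map-* 1# q n) (*-identityˡ _)

  -P-*P : ∀ p q → (-P p) *P q ≃ -P (p *P q)
  -P-*P []      q = ≃-refl
  -P-*P (a ∷ p) q =
    ≃-trans (+P-cong (map-neg q) (∷-cong (sym -0#≈0#) (-P-*P p q))) (≃-sym (-P-+P (map (a *_) q) (0# ∷ p *P q)))
    where
    map-neg : ∀ q → map (- a *_) q ≃ -P map (a *_) q
    map-neg []      = ≃-refl
    map-neg (b ∷ q) = ∷-cong (sym (-‿distribˡ-* a b)) (map-neg q)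

module TransferMatrices {c ℓ} (F : Field c ℓ) where
  open Poly F
  open Coefficientwise F
  open import Data.Nat using (_+_; _∸_; _≟_; _<?_; _≤?_)
  open import Relation.Binary.Reasoning.Setoid ≃-setoid

  ≡-mod-respʳ : ∀ {p q r m} → p ≡ q mod m → q ≃ r → p ≡ r mod m
  ≡-mod-respʳ {p} {q} {r} {m} (k , p-q≈km) q≃r =
    k , ≃⇒≈P (p -P r) (k *P m)
          (≃-trans (+P-cong ≃-refl (-P-cong (≃-sym q≃r))) (≈P⇒≃ (p -P q) (k *P m) p-q≈km))

  ∑ : ℕ → (ℕ → P) → P
  ∑ zero    φ = 0P
  ∑ (suc n) φ = φ 0 +P ∑ n (λ k → φ (suc k))

  ∑-cong : ∀ n {φ ψ} → (∀ k → k < n → φ k ≃ ψ k) → ∑ n φ ≃ ∑ n ψ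
  ∑-cong zero    _   = ≃-refl
  ∑-cong (suc n) φ≃ψ = +P-cong (φ≃ψ 0 z<s) (∑-cong n λ k k<n → φ≃ψ (suc k) (s<s k<n))

  ∑-zero : ∀ n {φ} → (∀ k → k < n → φ k ≃ 0P) → ∑ n φ ≃ 0P
  ∑-zero zero    _   = ≃-refl
  ∑-zero (suc n) φ≃0 = +P-cong (φ≃0 0 z<s) (∑-zero n λ k k<n → φ≃0 (suc k) (s<s k<n))

  ∑-+ : ∀ m n φ → ∑ (m + n) φ ≃ ∑ m φ +P ∑ n (λ k → φ (m + k))
  ∑-+ zero    n φ = ≃-refl
  ∑-+ (suc m) n φ = ≃-trans (+P-cong ≃-refl (∑-+ m n (λ k → φ (suc k))))
                            (≃-sym (+P-assoc (φ 0) _ _))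

  ∑-truncate : ∀ {n} i φ → i < n → (∀ k → i < k → k < n → φ k ≃ 0P) →
               ∑ n φ ≃ ∑ i φ +P φ i
  ∑-truncate {suc n} zero φ _ φ≃0 =
    ≃-trans (+P-cong ≃-refl (∑-zero n λ k k<n → φ≃0 (suc k) z<s (s<s k<n)))
            (≡⇒≃ (+P-identityʳ (φ 0)))
  ∑-truncate {suc n} (suc i) φ (s<s i<n) φ≃0 =
    ≃-trans (+P-cong ≃-refl (∑-truncate i (λ k → φ (suc k)) i<n
                               λ k i<k k<n → φ≃0 (suc k) (s<s i<k) (s<s k<n)))
            (≃-sym (+P-assoc (φ 0) _ _))

  -P-∑ : ∀ n φ → -P ∑ n φ ≃ ∑ n (λ k → -P φ k)
  -P-∑ zero    φ = ≃-refl
  -P-∑ (suc n) φ = ≃-trans (-P-+P (φ 0) _) (+P-cong ≃-refl (-P-∑ n (λ k → φ (suc k))))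

  ΣP≃∑ : ∀ n (f : Fin n → P) φ → (∀ k → f k ≃ φ (toℕ k)) → ΣP f ≃ ∑ n φ
  ΣP≃∑ zero    f φ f≃φ = ≃-refl
  ΣP≃∑ (suc n) f φ f≃φ =
    +P-cong (f≃φ Fin.zero) (ΣP≃∑ n (λ k → f (Fin.suc k)) (λ k → φ (suc k)) (λ k → f≃φ (Fin.suc k)))

  δ : ℕ → ℕ → P
  δ m n = if does (m ≟ n) then 1P else 0P

  δ-refl : ∀ m → δ m m ≡ 1P
  δ-refl m rewrite dec-true (m ≟ m) ≡.refl = ≡.refl

  δ-≢ : ∀ {m n} → m ≢ n → δ m n ≡ 0P
  δ-≢ {m} {n} m≢n rewrite dec-false (m ≟ n) m≢n = ≡.refl

  I≡δ : ∀ {n} (a b : Fin n) → I a b ≡ δ (toℕ a) (toℕ b)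
  I≡δ a b with a Fin.≟ b
  ... | yes ≡.refl = ≡.sym (δ-refl (toℕ a))
  ... | no a≢b     = ≡.sym (δ-≢ (λ eq → a≢b (Finₚ.toℕ-injective eq)))

  ∑-δ : ∀ n b φ → b < n → ∑ n (λ l → δ b l *P φ l) ≃ φ b
  ∑-δ (suc n) zero φ _ = begin
    δ 0 0 *P φ 0 +P ∑ n (λ l → δ 0 (suc l) *P φ (suc l))
      ≡⟨ cong (λ x → x *P φ 0 +P ∑ n (λ l → δ 0 (suc l) *P φ (suc l))) (δ-refl 0) ⟩
    1P *P φ 0 +P ∑ n (λ l → δ 0 (suc l) *P φ (suc l))
      ≈⟨ +P-cong (*P-identityˡ (φ 0)) (∑-zero n λ l _ → ≡⇒≃ (cong (_*P φ (suc l)) (δ-≢ {0} {suc l} λ ()))) ⟩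
    φ 0 +P 0P
      ≡⟨ +P-identityʳ (φ 0) ⟩
    φ 0 ∎
  ∑-δ (suc n) (suc b) φ (s<s b<n) =
    +P-cong (≡⇒≃ (cong (_*P φ 0) (δ-≢ {suc b} {0} λ ()))) (∑-δ n b (λ l → φ (suc l)) b<n)

  -- the nonzero entries of G and of the last row of T_i lie on a band of width t
  band : ℕ → ℕ → P → P
  band t d p = if does (d ≤? t) then p else 0P

  band-≤ : ∀ {t d} p → d ≤ t → band t d p ≡ p
  band-≤ {t} {d} p d≤t rewrite dec-true (d ≤? t) d≤t = ≡.refl

  band-> : ∀ {t d} p → t < d → band t d p ≡ 0P
  band-> {t} {d} p t<d rewrite dec-false (d ≤? t) (ℕₚ.<⇒≱ t<d) = ≡.refl

  -P-band-*P : ∀ t d p q → -P (band t d (-P p) *P q) ≃ band t d p *P q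
  -P-band-*P t d p q with does (d ≤? t)
  ... | true  = ≃-trans (-P-cong (-P-*P p q)) (-P-involutive _)
  ... | false = ≃-refl

  pad : ℕ → (ℕ → P) → ℕ → P
  pad zero    u n       = u n
  pad (suc s) u zero    = 0P
  pad (suc s) u (suc n) = pad s u n

  pad-+ : ∀ s u k → pad s u (s + k) ≡ u k
  pad-+ zero    u k = ≡.refl
  pad-+ (suc s) u k = pad-+ s u k

  pad-< : ∀ s u {n} → n < s → pad s u n ≡ 0P
  pad-< (suc s) u {zero}  _         = ≡.refl
  pad-< (suc s) u {suc n} (s<s n<s) = pad-< s u n<s

  ∑-window≃∑-band : ∀ s e (a : ℕ → P) u →
    ∑ (suc s) (λ l → a (suc s ∸ l) *P pad s u (e + l)) ≃
    ∑ (suc e) (λ k → band (suc s) (suc e ∸ k) (a (suc e ∸ k)) *P u k)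
  ∑-window≃∑-band s e a u = begin
    ∑ t (λ l → a (t ∸ l) *P pad s u (e + l))
      ≈⟨ ∑-cong t (λ l _ → ≡⇒≃ (χ-window l)) ⟨
    ∑ t (λ l → χ (e + l))
      ≈⟨ +P-cong (∑-zero e χ-before-window) ≃-refl ⟨
    ∑ e χ +P ∑ t (λ l → χ (e + l))
      ≈⟨ ∑-+ e t χ ⟨
    ∑ (e + t) χ
      ≡⟨ cong (λ n → ∑ n χ) e+t≡s+1+e ⟩
    ∑ (s + suc e) χ
      ≈⟨ ∑-+ s (suc e) χ ⟩
    ∑ s χ +P ∑ (suc e) (λ k → χ (s + k))
      ≈⟨ +P-cong (∑-zero s χ-before-pad) ≃-refl ⟩
    ∑ (suc e) (λ k → χ (s + k))
      ≈⟨ ∑-cong (suc e) (λ k _ → ≡⇒≃ (χ-band k)) ⟩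
    ∑ (suc e) (λ k → band t (suc e ∸ k) (a (suc e ∸ k)) *P u k) ∎
    where
    t : ℕ
    t = suc s

    -- both sides are the sum of χ m over m < e + t, indexed from two offsets
    χ : ℕ → P
    χ m = band t (e + t ∸ m) (a (e + t ∸ m)) *P pad s u m

    e+t≡s+1+e : e + t ≡ s + suc e
    e+t≡s+1+e = ≡.trans (ℕₚ.+-comm e t) (≡.sym (ℕₚ.+-suc s e))

    χ-window : ∀ l → χ (e + l) ≡ a (t ∸ l) *P pad s u (e + l)
    χ-window l rewrite ℕₚ.[m+n]∸[m+o]≡n∸o e t l =
      cong (_*P pad s u (e + l)) (band-≤ (a (t ∸ l)) (ℕₚ.m∸n≤m t l))

    χ-band : ∀ k → χ (s + k) ≡ band t (suc e ∸ k) (a (suc e ∸ k)) *P u k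
    χ-band k rewrite e+t≡s+1+e | ℕₚ.[m+n]∸[m+o]≡n∸o s (suc e) k | pad-+ s u k = ≡.refl

    χ-before-window : ∀ m → m < e → χ m ≃ 0P
    χ-before-window m m<e = ≡⇒≃ (cong (_*P pad s u m) (band-> (a (e + t ∸ m)) t<e+t∸m))
      where
      t<e+t∸m : t < e + t ∸ m
      t<e+t∸m = ≡.subst (_< e + t ∸ m) (ℕₚ.m+n∸m≡n e t)
                        (ℕₚ.∸-monoʳ-< m<e (ℕₚ.m≤m+n e t))

    χ-before-pad : ∀ m → m < s → χ m ≃ 0P
    χ-before-pad m m<s =
      ≃-trans (≡⇒≃ (cong (band t (e + t ∸ m) (a (e + t ∸ m)) *P_) (pad-< s u m<s)))
              (*P-zeroʳ (band t (e + t ∸ m) (a (e + t ∸ m))))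

  -- G[i,k] on natural indices: Gmat M t g a b reduces to Gentry t g (toℕ a) (toℕ b)
  Gentry : ℕ → (ℕ → ℕ → P) → ℕ → ℕ → P
  Gentry t g i k =
    if does (i ≟ k) then 1P
    else if does (k <? i) ∧ does (i ∸ k ≤? t) then -P g i (i ∸ k) else 0P

  Gentry-diag : ∀ t g i → Gentry t g i i ≡ 1P
  Gentry-diag t g i rewrite dec-true (i ≟ i) ≡.refl = ≡.refl

  Gentry-upper : ∀ t g {i k} → i < k → Gentry t g i k ≡ 0P
  Gentry-upper t g {i} {k} i<k
    rewrite dec-false (i ≟ k) (ℕₚ.<⇒≢ i<k) | dec-false (k <? i) (ℕₚ.<⇒≯ i<k) = ≡.refl

  Gentry-lower : ∀ t g {i k} → k < i → Gentry t g i k ≡ band t (i ∸ k) (-P g i (i ∸ k))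
  Gentry-lower t g {i} {k} k<i
    rewrite dec-false (i ≟ k) (ℕₚ.>⇒≢ k<i) | dec-true (k <? i) k<i = ≡.refl

  Tmat-last : ∀ t g e (a b : Fin t) → suc (toℕ a) ≡ t → Tmat t g e a b ≡ g (suc e) (t ∸ toℕ b)
  Tmat-last t g e a b 1+a≡t rewrite dec-true (suc (toℕ a) ≟ t) 1+a≡t = ≡.refl

  Tmat-shift : ∀ t g e (a b : Fin t) → suc (toℕ a) ≢ t → Tmat t g e a b ≡ δ (suc (toℕ a)) (toℕ b)
  Tmat-shift t g e a b 1+a≢t rewrite dec-false (suc (toℕ a) ≟ t) 1+a≢t = ≡.refl

  module InverseColumn (M t : ℕ) (g : ℕ → ℕ → P) (X : Mat M)
                       (GX≈I : Gmat M t g ⊗ X ≈M I) (j : Fin M) where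

    column : ℕ → P
    column k with k <? M
    ... | yes k<M = X (Fin.fromℕ< k<M) j
    ... | no  _   = 0P

    column-toℕ : ∀ a → column (toℕ a) ≃ X a j
    column-toℕ a with toℕ a <? M
    ... | yes a<M rewrite Finₚ.fromℕ<-toℕ a a<M = ≃-refl
    ... | no  a≮M = contradiction (Finₚ.toℕ<n a) a≮M

    row-equation : ∀ i → i < M →
      ∑ i (λ k → band t (i ∸ k) (-P g i (i ∸ k)) *P column k) +P column i ≃ δ i (toℕ j)
    row-equation i i<M = begin
      ∑ i (λ k → band t (i ∸ k) (-P g i (i ∸ k)) *P column k) +P column i
        ≈⟨ +P-cong (∑-cong i λ k k<i → ≡⇒≃ (cong (_*P column k) (≡.sym (Gentry-lower t g k<i))))
                   (≃-sym (≃-trans (≡⇒≃ (cong (_*P column i) (Gentry-diag t g i)))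
                                   (*P-identityˡ (column i)))) ⟩
      ∑ i φ +P φ i
        ≈⟨ ∑-truncate i φ i<M (λ k i<k _ → ≡⇒≃ (cong (_*P column k) (Gentry-upper t g i<k))) ⟨
      ∑ M φ
        ≡⟨ cong (λ x → ∑ M (λ k → Gentry t g x k *P column k)) (≡.sym (Finₚ.toℕ-fromℕ< i<M)) ⟩
      ∑ M (λ k → Gentry t g (toℕ a) k *P column k)
        ≈⟨ ΣP≃∑ M _ _ (λ k → *P-congˡ (Gmat M t g a k) (≃-sym (column-toℕ k))) ⟨
      (Gmat M t g ⊗ X) a j
        ≈⟨ ≈P⇒≃ _ _ (GX≈I a j) ⟩
      I a j
        ≡⟨ I≡δ a j ⟩
      δ (toℕ a) (toℕ j)
        ≡⟨ cong (λ x → δ x (toℕ j)) (Finₚ.toℕ-fromℕ< i<M) ⟩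
      δ i (toℕ j) ∎
      where
      a : Fin M
      a = Fin.fromℕ< i<M
      φ : ℕ → P
      φ k = Gentry t g i k *P column k

    column≃δ : ∀ i → i < M → (∀ k → k < i → column k ≃ 0P) → column i ≃ δ i (toℕ j)
    column≃δ i i<M earlier≃0 = ≃-trans (+P-cong (≃-sym sum≃0) ≃-refl) (row-equation i i<M)
      where
      sum≃0 : ∑ i (λ k → band t (i ∸ k) (-P g i (i ∸ k)) *P column k) ≃ 0P
      sum≃0 = ∑-zero i λ k k<i →
        ≃-trans (*P-congˡ (band t (i ∸ k) (-P g i (i ∸ k))) (earlier≃0 k k<i))
                (*P-zeroʳ (band t (i ∸ k) (-P g i (i ∸ k))))

    column-below : ∀ k → k < toℕ j → column k ≃ 0P
    column-below = <-rec _ λ k rec k<j →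
      ≃-trans (column≃δ k (ℕₚ.<-trans k<j (Finₚ.toℕ<n j))
                        (λ m m<k → rec m<k (ℕₚ.<-trans m<k k<j)))
              (≡⇒≃ (δ-≢ (ℕₚ.<⇒≢ k<j)))

    column-diagonal : column (toℕ j) ≃ 1P
    column-diagonal =
      ≃-trans (column≃δ (toℕ j) (Finₚ.toℕ<n j) column-below) (≡⇒≃ (δ-refl (toℕ j)))

    column-recurrence : ∀ i → toℕ j < i → i < M →
      column i ≃ ∑ i (λ k → band t (i ∸ k) (g i (i ∸ k)) *P column k)
    column-recurrence i j<i i<M = begin
      column i
        ≈⟨ +P-inverseʳ-unique S (column i) (≃-trans (row-equation i i<M) (≡⇒≃ (δ-≢ (ℕₚ.>⇒≢ j<i)))) ⟩
      -P S
        ≈⟨ -P-∑ i _ ⟩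
      ∑ i (λ k → -P (band t (i ∸ k) (-P g i (i ∸ k)) *P column k))
        ≈⟨ ∑-cong i (λ k _ → -P-band-*P t (i ∸ k) (g i (i ∸ k)) (column k)) ⟩
      ∑ i (λ k → band t (i ∸ k) (g i (i ∸ k)) *P column k) ∎
      where
      S : P
      S = ∑ i (λ k → band t (i ∸ k) (-P g i (i ∸ k)) *P column k)

    u : ℕ → P
    u k = column (toℕ j + k)

    u-start : u 0 ≃ 1P
    u-start rewrite ℕₚ.+-identityʳ (toℕ j) = column-diagonal

    u-recurrence : ∀ d → toℕ j + suc d < M →
      u (suc d) ≃ ∑ (suc d) (λ k → band t (suc d ∸ k) (g (toℕ j + suc d) (suc d ∸ k)) *P u k)
    u-recurrence d i<M = begin
      column i
        ≈⟨ column-recurrence i (ℕₚ.m<m+n (toℕ j) z<s) i<M ⟩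
      ∑ i ψ
        ≈⟨ ∑-+ (toℕ j) (suc d) ψ ⟩
      ∑ (toℕ j) ψ +P ∑ (suc d) (λ k → ψ (toℕ j + k))
        ≈⟨ +P-cong (∑-zero (toℕ j) ψ-below) ≃-refl ⟩
      ∑ (suc d) (λ k → ψ (toℕ j + k))
        ≈⟨ ∑-cong (suc d) (λ k _ → ≡⇒≃ (cong (λ n → band t n (g i n) *P u k)
                                                 (ℕₚ.[m+n]∸[m+o]≡n∸o (toℕ j) (suc d) k))) ⟩
      ∑ (suc d) (λ k → band t (suc d ∸ k) (g i (suc d ∸ k)) *P u k) ∎
      where
      i : ℕ
      i = toℕ j + suc d
      ψ : ℕ → P
      ψ k = band t (i ∸ k) (g i (i ∸ k)) *P column k
      ψ-below : ∀ k → k < toℕ j → ψ k ≃ 0P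
      ψ-below k k<j = ≃-trans (*P-congˡ (band t (i ∸ k) (g i (i ∸ k))) (column-below k k<j))
                              (*P-zeroʳ (band t (i ∸ k) (g i (i ∸ k))))

  Tprod-lastColumn≃window : ∀ s g j M (u : ℕ → P) → u 0 ≃ 1P →
    (∀ d → j + suc d < M →
       u (suc d) ≃ ∑ (suc s) (λ l → g (j + suc d) (suc s ∸ l) *P pad s u (d + l))) →
    ∀ d → j + d < M → ∀ a → Tprod (suc s) g j d a (fromℕ s) ≃ pad s u (d + toℕ a)
  Tprod-lastColumn≃window s g j M u u-start u-step zero _ a = begin
    I a (fromℕ s)              ≡⟨ I≡δ a (fromℕ s) ⟩
    δ (toℕ a) (toℕ (fromℕ s))  ≡⟨ cong (δ (toℕ a)) (Finₚ.toℕ-fromℕ s) ⟩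
    δ (toℕ a) s                ≈⟨ δ≃pad (toℕ a ≟ s) ⟩
    pad s u (toℕ a)            ∎
    where
    δ≃pad : Dec (toℕ a ≡ s) → δ (toℕ a) s ≃ pad s u (toℕ a)
    δ≃pad (yes a≡s) = begin
      δ (toℕ a) s      ≡⟨ cong (λ x → δ x s) a≡s ⟩
      δ s s            ≡⟨ δ-refl s ⟩
      1P               ≈⟨ u-start ⟨
      u 0              ≡⟨ pad-+ s u 0 ⟨
      pad s u (s + 0)  ≡⟨ cong (pad s u) (≡.trans (ℕₚ.+-identityʳ s) (≡.sym a≡s)) ⟩
      pad s u (toℕ a)  ∎
    δ≃pad (no a≢s) = ≡⇒≃ (≡.trans (δ-≢ a≢s) (≡.sym (pad-< s u a<s)))
      where
      a<s : toℕ a < s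
      a<s = ℕₚ.≤∧≢⇒< (Finₚ.toℕ≤pred[n] a) a≢s
  Tprod-lastColumn≃window s g j M u u-start u-step (suc d) j+1+d<M a = next-column (toℕ a ≟ s)
    where
    t : ℕ
    t = suc s

    j+d<M : j + d < M
    j+d<M = ℕₚ.<-trans (ℕₚ.+-monoʳ-< j (ℕₚ.n<1+n d)) j+1+d<M

    apply-T : (row : ℕ → P) → (∀ l → Tmat t g (j + d) a l ≡ row (toℕ l)) →
              Tprod t g j (suc d) a (fromℕ s) ≃ ∑ t (λ l → row l *P pad s u (d + l))
    apply-T row row≡ = ΣP≃∑ t _ (λ l → row l *P pad s u (d + l)) λ l →
      ≃-trans (≡⇒≃ (cong (_*P Tprod t g j d l (fromℕ s)) (row≡ l)))
              (*P-congˡ (row (toℕ l)) (Tprod-lastColumn≃window s g j M u u-start u-step d j+d<M l))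

    next-column : Dec (toℕ a ≡ s) → Tprod t g j (suc d) a (fromℕ s) ≃ pad s u (suc d + toℕ a)
    next-column (yes a≡s) = begin
      Tprod t g j (suc d) a (fromℕ s)
        ≈⟨ apply-T (λ l → g (j + suc d) (t ∸ l)) last-row ⟩
      ∑ t (λ l → g (j + suc d) (t ∸ l) *P pad s u (d + l))
        ≈⟨ u-step d j+1+d<M ⟨
      u (suc d)
        ≡⟨ pad-+ s u (suc d) ⟨
      pad s u (s + suc d)
        ≡⟨ cong (pad s u) (≡.trans (ℕₚ.+-comm s (suc d)) (cong (suc d +_) (≡.sym a≡s))) ⟩
      pad s u (suc d + toℕ a) ∎
      where
      last-row : ∀ l → Tmat t g (j + d) a l ≡ g (j + suc d) (t ∸ toℕ l)
      last-row l = ≡.trans (Tmat-last t g (j + d) a l (cong suc a≡s))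
                           (cong (λ i → g i (t ∸ toℕ l)) (≡.sym (ℕₚ.+-suc j d)))
    next-column (no a≢s) = begin
      Tprod t g j (suc d) a (fromℕ s)
        ≈⟨ apply-T (δ (suc (toℕ a))) (λ l → Tmat-shift t g (j + d) a l (a≢s ∘ ℕₚ.suc-injective)) ⟩
      ∑ t (λ l → δ (suc (toℕ a)) l *P pad s u (d + l))
        ≈⟨ ∑-δ t (suc (toℕ a)) (λ l → pad s u (d + l)) (s<s a<s) ⟩
      pad s u (d + suc (toℕ a))
        ≡⟨ cong (pad s u) (ℕₚ.+-suc d (toℕ a)) ⟩
      pad s u (suc d + toℕ a) ∎
      where
      a<s : toℕ a < s
      a<s = ℕₚ.≤∧≢⇒< (Finₚ.toℕ≤pred[n] a) a≢s

  inverse≃Tseg : ∀ M s g (X : Mat M) → Gmat M (suc s) g ⊗ X ≈M I →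
    ∀ (i j : Fin M) → toℕ j ≤ toℕ i →
    X i j ≃ Tseg (suc s) g (toℕ j) (toℕ i) (fromℕ s) (fromℕ s)
  inverse≃Tseg M s g X GX≈I i j j≤i = begin
    X i j                          ≈⟨ column-toℕ i ⟨
    column (toℕ i)                 ≡⟨ cong column (ℕₚ.m+[n∸m]≡n j≤i) ⟨
    u d                            ≡⟨ pad-+ s u d ⟨
    pad s u (s + d)                ≡⟨ cong (pad s u) s+d≡d+s ⟩
    pad s u (d + toℕ (fromℕ s))    ≈⟨ Tprod-lastColumn≃window s g (toℕ j) M u u-start u-step d j+d<M (fromℕ s) ⟨
    Tprod (suc s) g (toℕ j) d (fromℕ s) (fromℕ s) ∎
    where
    open InverseColumn M (suc s) g X GX≈I j

    d : ℕ
    d = toℕ i ∸ toℕ j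

    j+d<M : toℕ j + d < M
    j+d<M = ≡.subst (_< M) (≡.sym (ℕₚ.m+[n∸m]≡n j≤i)) (Finₚ.toℕ<n i)

    s+d≡d+s : s + d ≡ d + toℕ (fromℕ s)
    s+d≡d+s = ≡.trans (ℕₚ.+-comm s d) (cong (d +_) (≡.sym (Finₚ.toℕ-fromℕ s)))

    u-step : ∀ e → toℕ j + suc e < M →
      u (suc e) ≃ ∑ (suc s) (λ l → g (toℕ j + suc e) (suc s ∸ l) *P pad s u (e + l))
    u-step e j+1+e<M =
      ≃-trans (u-recurrence e j+1+e<M) (≃-sym (∑-window≃∑-band s e (g (toℕ j + suc e)) u))

lemma3p5 : ∀ {c ℓ} (F : Field c ℓ) → let open Poly F in
    (N : ℕ) (R : Fin N → Fin N → Field.Carrier F)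
    (M s : ℕ) → let t = suc s in
    (g : ℕ → ℕ → P) →
    (∀ i → i < M → g i 0 ≈P 1P) →
    (∀ i j → i < M → 1 ≤ j → j ≤ t → i < j → g i j ≈P 0P) →
    (Ginv : Mat M) → Gmat M t g ⊗ Ginv ≈M I → Ginv ⊗ Gmat M t g ≈M I →
    (H : Mat M) → (∀ i j → H i j ≡ Ginv i j mod charPoly R) →
    ∀ (i j : Fin M) → toℕ j ≤ toℕ i →
    H i j ≡ Tseg t g (toℕ j) (toℕ i) (fromℕ s) (fromℕ s) mod charPoly R
lemma3p5 F N R M s g _ _ Ginv GGinv≈I _ H H≡Ginv i j j≤i =
  ≡-mod-respʳ (H≡Ginv i j) (inverse≃Tseg M s g Ginv GGinv≈I i j j≤i)
  where open TransferMatrices F
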